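{- Let $k \ge 2$ be an integer and $G$ a graph of order $n$. If $\beta^k(G) > 0$, then $G$ is not bipartite and $\beta^k(G) \le \frac{n-k}{k}$. Consequently, if $\beta^k(G) \ge 1$, then $n \ge 2k$.
   Context: All graphs are finite and simple. For $S\subseteq V(G)$, $\Lambda^k_G(S)$ is the set of vertices with at least $k$ neighbors in $S$, and $\beta^k(G)=\min\{|\Lambda^k_G(S)|/|S| : S\subseteq V(G),\ |S|\ge k,\ \Lambda^k_G(S)\ne V(G)\}$, with $\beta^k(G)=0$ if $|V(G)|<k$. -}

module Defs where

open import Data.Bool using (Bool; true; false; if_then_else_; _∧_; not)
open import Data.Nat as ℕ using (ℕ; zero; suc; _≤ᵇ_; _<ᵇ_)
open import Data.Fin using (Fin)
open import Data.Vec using (Vec; []; _∷_; tabulate)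
open import Data.List using (List; []; _∷_; _++_; foldr) renaming (map to lmap)
open import Data.Maybe using (Maybe; just; nothing)
open import Data.Product using (Σ; _×_; _,_)
open import Data.Fin.Subset using (Subset; inside; outside; ⊤; _∩_; ∣_∣)
open import Data.Integer using (+_)
open import Data.Rational using (ℚ; _/_; 0ℚ; _⊓_)
open import Relation.Binary.PropositionalEquality using (_≡_; _≢_)
open import Relation.Nullary using (does)
open import Data.Vec.Properties using (≡-dec)
import Data.Bool.Properties as BoolP

record Graph (n : ℕ) : Set where
  field
    adj    : Fin n → Fin n → Bool
    sym    : ∀ u v → adj u v ≡ adj v u
    irrefl : ∀ v → adj v v ≡ false
open Graph public

Bipartite : ∀ {n} → Graph n → Set
Bipartite {n} G = Σ (Fin n → Bool) λ c → ∀ u v → adj G u v ≡ true → c u ≢ c v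

N : ∀ {n} → Graph n → Fin n → Subset n
N G v = tabulate (λ u → adj G v u)

Λ : ∀ {n} → ℕ → Graph n → Subset n → Subset n
Λ k G S = tabulate (λ v → k ≤ᵇ ∣ N G v ∩ S ∣)

allSubsets : (n : ℕ) → List (Subset n)
allSubsets zero = [] ∷ []
allSubsets (suc n) = lmap (inside ∷_) (allSubsets n) ++ lmap (outside ∷_) (allSubsets n)

-- a / b as a rational (b = 0 never occurs for admissible S; mapped to 0).
ratio : ℕ → ℕ → ℚ
ratio a zero = 0ℚ
ratio a (suc b) = + a / suc b

admissible : ∀ {n} → ℕ → Graph n → Subset n → Bool
admissible k G S = (k ≤ᵇ ∣ S ∣) ∧ not (does (≡-dec BoolP._≟_ (Λ k G S) ⊤))

minRatio : ∀ {n} → ℕ → Graph n → List (Subset n) → Maybe ℚ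
minRatio k G [] = nothing
minRatio k G (S ∷ Ss) with admissible k G S | minRatio k G Ss
... | false | m = m
... | true  | nothing = just (ratio ∣ Λ k G S ∣ ∣ S ∣)
... | true  | just q = just (ratio ∣ Λ k G S ∣ ∣ S ∣ ⊓ q)

-- β^k(G); equals 0 if |V(G)| < k (and, by convention, if no admissible S).
β : ∀ {n} → ℕ → Graph n → ℚ
β {n} k G with n <ᵇ k | minRatio k G (allSubsets n)
... | true  | _ = 0ℚ
... | false | nothing = 0ℚ
... | false | just q = q

{-# OPTIONS --safe #-}
-- A vertex of Λᵏ(S), for a k-set S, is adjacent to every vertex of S and hence,
-- having no loop, lies outside S. So every k-set S is admissible and
-- β ≤ |Λᵏ(S)|/k ≤ (n − k)/k; if β ≥ 1 this gives k ≤ kβ ≤ n − k.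
-- If β > 0 then no Λᵏ(S) is empty, so every set of at most k vertices, extended to
-- a k-set S, has a common neighbour in Λᵏ(S). For k ≥ 2 this produces a triangle:
-- any vertex w, a neighbour u of w, and a common neighbour of u and w.
module Submission where

open import Defs
open import Data.Nat using (ℕ; _≤_; _*_)
open import Data.Product using (_×_)
open import Relation.Nullary using (¬_)
open import Data.Integer using (+_)
open import Data.Rational using (ℚ; 0ℚ; 1ℚ; _/_; _<_) renaming (_≤_ to _≤ℚ_; _*_ to _*ℚ_; _-_ to _-ℚ_)

open import Data.Bool using (Bool; true; false; T; _∧_; not)
import Data.Bool.Properties as Bool
open import Data.Fin using (Fin)
open import Data.Fin.Subset using (Subset; inside; outside; _∈_; _∉_; _⊆_; _⊂_; _∩_; _∪_; ∣_∣; ⁅_⁆; ⊤; ⊥; ∁; Nonempty)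
import Data.Fin.Subset.Properties as Subset
open import Data.Integer as ℤ using ()
import Data.Integer.Properties as ℤ
open import Data.List using (_∷_; map)
open import Data.List.Membership.Propositional using () renaming (_∈_ to _∈ₗ_)
open import Data.List.Membership.Propositional.Properties using (∈-++⁺ˡ; ∈-++⁺ʳ; ∈-map⁺)
open import Data.List.Relation.Unary.Any using (here; there)
open import Data.Maybe using (just; nothing)
open import Data.Nat as ℕ using (zero; suc; _+_; _∸_; _<ᵇ_; z≤n; s≤s; z<s; NonZero)
import Data.Nat.Properties as ℕ
open import Data.Product as Product using (∃; _,_; proj₁; proj₂)
open import Data.Rational using (toℚᵘ) renaming (-_ to -ℚ_)
import Data.Rational.Properties as ℚ
open import Data.Rational.Unnormalised as ℚᵘ using (mkℚᵘ; *≡*; *≤*)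
import Data.Rational.Unnormalised.Properties as ℚᵘ
open import Data.Sum using (inj₁; inj₂)
open import Data.Vec using ([]; _∷_; tabulate)
open import Data.Vec.Properties using (lookup∘tabulate; []=⇒lookup; ≡-dec)
open import Function using (_∘_; id)
open import Function.Bundles using (Equivalence)
open import Relation.Binary.PropositionalEquality as ≡ using (_≡_; _≢_; refl; subst; cong; cong₂)
open import Relation.Nullary using (yes; no; contradiction)
open import Relation.Nullary.Decidable using (dec-false)

private variable
  n : ℕ
  G : Graph n
  p q : Subset n

≢∧≢⇒≡ : ∀ {a b c : Bool} → a ≢ b → b ≢ c → a ≡ c
≢∧≢⇒≡ a≢b b≢c = ≡.trans (Bool.¬-not a≢b) (≡.sym (Bool.¬-not (b≢c ∘ ≡.sym)))

x∈tabulate⇒f[x] : ∀ {f : Fin n → Bool} {x} → x ∈ tabulate f → f x ≡ true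
x∈tabulate⇒f[x] {f = f} {x = x} x∈ = ≡.trans (≡.sym (lookup∘tabulate f x)) ([]=⇒lookup x∈)

∣p∣>0⇒Nonempty : ∀ {n} {p : Subset n} → 0 ℕ.< ∣ p ∣ → Nonempty p
∣p∣>0⇒Nonempty {n = n} {p = p} 0<∣p∣ with Subset.nonempty? p
... | yes nonempty = nonempty
... | no  empty    =
  contradiction (≡.trans (cong ∣_∣ (Subset.Empty-unique empty)) (Subset.∣⊥∣≡0 n)) (ℕ.>⇒≢ 0<∣p∣)

∣q∣≤∣p∩q∣⇒q⊆p : ∣ q ∣ ≤ ∣ p ∩ q ∣ → q ⊆ p
∣q∣≤∣p∩q∣⇒q⊆p {q = q} {p = p} ∣q∣≤∣p∩q∣ {x} x∈q with x Subset.∈? p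
... | yes x∈p = x∈p
... | no  x∉p = contradiction ∣q∣≤∣p∩q∣ (ℕ.<⇒≱ (Subset.p⊂q⇒∣p∣<∣q∣ p∩q⊂q))
  where
  p∩q⊂q : p ∩ q ⊂ q
  p∩q⊂q = Subset.p∩q⊆q p q , x , x∈q , x∉p ∘ proj₁ ∘ Subset.x∈p∩q⁻ p q

∣p∪q∣≤∣p∣+∣q∣ : ∀ (p q : Subset n) → ∣ p ∪ q ∣ ≤ ∣ p ∣ + ∣ q ∣
∣p∪q∣≤∣p∣+∣q∣ []            []            = z≤n
∣p∪q∣≤∣p∣+∣q∣ (inside  ∷ p) (s ∷ q)       =
  s≤s (ℕ.≤-trans (∣p∪q∣≤∣p∣+∣q∣ p q) (ℕ.+-monoʳ-≤ ∣ p ∣ (Subset.∣p∣≤∣x∷p∣ s q)))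
∣p∪q∣≤∣p∣+∣q∣ (outside ∷ p) (inside  ∷ q) =
  subst (suc ∣ p ∪ q ∣ ≤_) (≡.sym (ℕ.+-suc ∣ p ∣ ∣ q ∣)) (s≤s (∣p∪q∣≤∣p∣+∣q∣ p q))
∣p∪q∣≤∣p∣+∣q∣ (outside ∷ p) (outside ∷ q) = ∣p∪q∣≤∣p∣+∣q∣ p q

superset-of-size : ∀ k (T : Subset n) → ∣ T ∣ ≤ k → k ≤ n → ∃ λ S → T ⊆ S × ∣ S ∣ ≡ k
superset-of-size {zero}  _       []           _            z≤n       = [] , id , refl
superset-of-size {suc n} zero    (inside ∷ T) ()           _
superset-of-size {suc n} (suc k) (inside ∷ T) (s≤s ∣T∣≤k) (s≤s k≤n) =
  Product.map (inside ∷_) (Product.map Subset.in⊆in (cong suc)) (superset-of-size k T ∣T∣≤k k≤n)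
superset-of-size {suc n} k (outside ∷ T) ∣T∣≤k k≤1+n with ℕ.m≤n⇒m<n∨m≡n k≤1+n
... | inj₁ (s≤s k≤n) =
  Product.map (outside ∷_) (Product.map Subset.out⊆ id) (superset-of-size k T ∣T∣≤k k≤n)
... | inj₂ refl      = ⊤ , Subset.⊆⊤ , Subset.∣⊤∣≡n (suc n)

subset-of-size : ∀ k → k ≤ n → ∃ λ (S : Subset n) → ∣ S ∣ ≡ k
subset-of-size {n} k k≤n =
  Product.map₂ proj₂ (superset-of-size k ⊥ (ℕ.≤-trans (ℕ.≤-reflexive (Subset.∣⊥∣≡0 n)) z≤n) k≤n)

∈-allSubsets : ∀ (S : Subset n) → S ∈ₗ allSubsets n
∈-allSubsets []                      = here refl
∈-allSubsets {suc n} (inside  ∷ S) = ∈-++⁺ˡ (∈-map⁺ (inside ∷_) (∈-allSubsets S))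
∈-allSubsets {suc n} (outside ∷ S) =
  ∈-++⁺ʳ (map (inside ∷_) (allSubsets n)) (∈-map⁺ (outside ∷_) (∈-allSubsets S))

∣⁅x⁆∪⁅y⁆∣≤2 : ∀ (x y : Fin n) → ∣ ⁅ x ⁆ ∪ ⁅ y ⁆ ∣ ≤ 2
∣⁅x⁆∪⁅y⁆∣≤2 x y = ℕ.≤-trans (∣p∪q∣≤∣p∣+∣q∣ ⁅ x ⁆ ⁅ y ⁆)
  (ℕ.≤-reflexive (cong₂ _+_ (Subset.∣⁅x⁆∣≡1 x) (Subset.∣⁅x⁆∣≡1 y)))

toℚᵘ-/ : ∀ i m → toℚᵘ (i / suc m) ℚᵘ.≃ mkℚᵘ i m
toℚᵘ-/ i m = ℚ.toℚᵘ-fromℚᵘ (mkℚᵘ i m)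

k*ratio[a,k]≡a : ∀ a k .{{_ : NonZero k}} → (+ k / 1) *ℚ ratio a k ≡ + a / 1
k*ratio[a,k]≡a a k@(suc m) = ℚ.toℚᵘ-injective (begin
  toℚᵘ ((+ k / 1) *ℚ (+ a / k))        ≈⟨ ℚ.toℚᵘ-homo-* (+ k / 1) (+ a / k) ⟩
  toℚᵘ (+ k / 1) ℚᵘ.* toℚᵘ (+ a / k)   ≈⟨ ℚᵘ.*-cong (toℚᵘ-/ (+ k) 0) (toℚᵘ-/ (+ a) m) ⟩
  mkℚᵘ (+ k) 0 ℚᵘ.* mkℚᵘ (+ a) m       ≈⟨ *≡* cross-multiplied ⟩
  mkℚᵘ (+ a) 0                         ≈⟨ toℚᵘ-/ (+ a) 0 ⟨
  toℚᵘ (+ a / 1)                       ∎)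
  where
  open ℚᵘ.≃-Reasoning
  cross-multiplied : + k ℤ.* + a ℤ.* + 1 ≡ + a ℤ.* + (1 ℕ.* k)
  cross-multiplied = ≡.trans (ℤ.*-identityʳ _)
    (≡.trans (ℤ.*-comm (+ k) (+ a)) (cong (λ d → + a ℤ.* + d) (≡.sym (ℕ.*-identityˡ k))))

[n]-[k]≡[n∸k] : ∀ {n k} → k ≤ n → (+ n / 1) -ℚ (+ k / 1) ≡ + (n ∸ k) / 1
[n]-[k]≡[n∸k] {n} {k} k≤n = ℚ.toℚᵘ-injective toℚᵘ-equation
  where
  cross-multiplied : (+ n ℤ.* + 1 ℤ.+ (ℤ.- + k) ℤ.* + 1) ℤ.* + 1 ≡ + (n ∸ k) ℤ.* + 1
  cross-multiplied = begin
    (+ n ℤ.* + 1 ℤ.+ (ℤ.- + k) ℤ.* + 1) ℤ.* + 1 ≡⟨ ℤ.*-identityʳ _ ⟩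
    + n ℤ.* + 1 ℤ.+ (ℤ.- + k) ℤ.* + 1           ≡⟨ cong₂ ℤ._+_ (ℤ.*-identityʳ (+ n)) (ℤ.*-identityʳ (ℤ.- + k)) ⟩
    + n ℤ.+ (ℤ.- + k)                           ≡⟨ ℤ.m-n≡m⊖n n k ⟩
    n ℤ.⊖ k                                     ≡⟨ ℤ.⊖-≥ k≤n ⟩
    + (n ∸ k)                                   ≡⟨ ℤ.*-identityʳ (+ (n ∸ k)) ⟨
    + (n ∸ k) ℤ.* + 1                           ∎
    where open ≡.≡-Reasoning

  toℚᵘ-equation : toℚᵘ ((+ n / 1) -ℚ (+ k / 1)) ℚᵘ.≃ toℚᵘ (+ (n ∸ k) / 1)
  toℚᵘ-equation = begin
    toℚᵘ ((+ n / 1) -ℚ (+ k / 1))           ≈⟨ ℚ.toℚᵘ-homo-+ (+ n / 1) (-ℚ (+ k / 1)) ⟩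
    toℚᵘ (+ n / 1) ℚᵘ.+ toℚᵘ (-ℚ (+ k / 1)) ≈⟨ ℚᵘ.+-cong (toℚᵘ-/ (+ n) 0) toℚᵘ[-k]≃-k ⟩
    mkℚᵘ (+ n) 0 ℚᵘ.- mkℚᵘ (+ k) 0          ≈⟨ *≡* cross-multiplied ⟩
    mkℚᵘ (+ (n ∸ k)) 0                      ≈⟨ toℚᵘ-/ (+ (n ∸ k)) 0 ⟨
    toℚᵘ (+ (n ∸ k) / 1)                    ∎
    where
    open ℚᵘ.≃-Reasoning
    toℚᵘ[-k]≃-k = ℚᵘ.≃-trans (ℚ.toℚᵘ-homo‿- (+ k / 1)) (ℚᵘ.-‿cong (toℚᵘ-/ (+ k) 0))

a≤b⇒[a]≤[b] : ∀ {a b} → a ≤ b → + a / 1 ≤ℚ + b / 1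
a≤b⇒[a]≤[b] {a} {b} a≤b = ℚ.toℚᵘ-cancel-≤
  (ℚᵘ.≤-respˡ-≃ (ℚᵘ.≃-sym (toℚᵘ-/ (+ a) 0)) (ℚᵘ.≤-respʳ-≃ (ℚᵘ.≃-sym (toℚᵘ-/ (+ b) 0))
    (*≤* (ℤ.*-monoʳ-≤-nonNeg (+ 1) (ℤ.+≤+ a≤b)))))

[a]≤[b]⇒a≤b : ∀ {a b} → + a / 1 ≤ℚ + b / 1 → a ≤ b
[a]≤[b]⇒a≤b {a} {b} [a]≤[b]
  with ℚᵘ.≤-respˡ-≃ (toℚᵘ-/ (+ a) 0) (ℚᵘ.≤-respʳ-≃ (toℚᵘ-/ (+ b) 0) (ℚ.toℚᵘ-mono-≤ [a]≤[b]))
... | *≤* a*1≤b*1 = ℤ.drop‿+≤+ (ℤ.*-cancelʳ-≤-pos (+ a) (+ b) (+ 1) a*1≤b*1)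

[k]*-mono-≤ : ∀ k {p q} → p ≤ℚ q → (+ k / 1) *ℚ p ≤ℚ (+ k / 1) *ℚ q
[k]*-mono-≤ k = ℚ.*-monoˡ-≤-nonNeg (+ k / 1) {{ℚ.normalize-nonNeg k 1}}

0<ratio[a,d]⇒0<a : ∀ a d → 0ℚ < ratio a d → 0 ℕ.< a
0<ratio[a,d]⇒0<a zero    zero    0<0 = contradiction 0<0 (ℚ.<-irrefl refl)
0<ratio[a,d]⇒0<a zero    (suc d) 0<0 = contradiction (subst (0ℚ <_) (ℚ.0/n≡0 (suc d)) 0<0) (ℚ.<-irrefl refl)
0<ratio[a,d]⇒0<a (suc a) _       _   = z<s

record Triangle (G : Graph n) : Set where
  field
    x y z : Fin n
    xy : adj G x y ≡ true
    yz : adj G y z ≡ true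
    xz : adj G x z ≡ true

triangle⇒¬bipartite : Triangle G → ¬ Bipartite G
triangle⇒¬bipartite t (colour , proper) = proper x z xz (≢∧≢⇒≡ (proper x y xy) (proper y z yz))
  where open Triangle t

module _ {n} (G : Graph n) where

  ∈N⇒adj : ∀ {x y} → x ∈ N G y → adj G y x ≡ true
  ∈N⇒adj = x∈tabulate⇒f[x]

  ∈Λ⇒k≤∣N∩S∣ : ∀ {k S x} → x ∈ Λ k G S → k ≤ ∣ N G x ∩ S ∣
  ∈Λ⇒k≤∣N∩S∣ {k} x∈Λ = ℕ.≤ᵇ⇒≤ k _ (Equivalence.from Bool.T-≡ (x∈tabulate⇒f[x] x∈Λ))

  module _ {k} {S : Subset n} (∣S∣≡k : ∣ S ∣ ≡ k) where

    ∈Λ⇒⊆N : ∀ {x} → x ∈ Λ k G S → S ⊆ N G x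
    ∈Λ⇒⊆N x∈Λ = ∣q∣≤∣p∩q∣⇒q⊆p (subst (_≤ _) (≡.sym ∣S∣≡k) (∈Λ⇒k≤∣N∩S∣ x∈Λ))

    ∈Λ⇒∉ : ∀ {x} → x ∈ Λ k G S → x ∉ S
    ∈Λ⇒∉ {x} x∈Λ x∈S with ≡.trans (≡.sym (∈N⇒adj (∈Λ⇒⊆N x∈Λ x∈S))) (irrefl G x)
    ... | ()

    ∣Λ∣+k≤n : ∣ Λ k G S ∣ + k ≤ n
    ∣Λ∣+k≤n = ℕ.m≤o∸n⇒m+n≤o _ k≤n (begin
      ∣ Λ k G S ∣ ≤⟨ Subset.p⊆q⇒∣p∣≤∣q∣ (Subset.x∉p⇒x∈∁p ∘ ∈Λ⇒∉) ⟩
      ∣ ∁ S ∣     ≡⟨ Subset.∣∁p∣≡n∸∣p∣ S ⟩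
      n ∸ ∣ S ∣   ≡⟨ cong (n ∸_) ∣S∣≡k ⟩
      n ∸ k       ∎)
      where
      open ℕ.≤-Reasoning
      k≤n = subst (_≤ n) ∣S∣≡k (Subset.∣p∣≤n S)

    Λ≢⊤ : .{{_ : NonZero k}} → Λ k G S ≢ ⊤
    Λ≢⊤ Λ≡⊤ with ∣p∣>0⇒Nonempty (subst (0 ℕ.<_) (≡.sym ∣S∣≡k) (ℕ.>-nonZero⁻¹ k))
    ... | x , x∈S = ∈Λ⇒∉ (subst (x ∈_) (≡.sym Λ≡⊤) Subset.∈⊤) x∈S

module _ {n k : ℕ} {G : Graph n} where

  admissible⁺ : ∀ {S} → k ≤ ∣ S ∣ → Λ k G S ≢ ⊤ → admissible k G S ≡ true
  admissible⁺ {S} k≤∣S∣ Λ≢⊤ = cong₂ (λ b c → b ∧ not c)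
    (Equivalence.to Bool.T-≡ (ℕ.≤⇒≤ᵇ k≤∣S∣)) (dec-false (≡-dec Bool._≟_ (Λ k G S) ⊤) Λ≢⊤)

  minRatio-≤ : ∀ {S} Ss → S ∈ₗ Ss → admissible k G S ≡ true →
               ∃ λ q → minRatio k G Ss ≡ just q × q ≤ℚ ratio ∣ Λ k G S ∣ ∣ S ∣
  minRatio-≤ (S ∷ Ss) (here refl) adm rewrite adm with minRatio k G Ss
  ... | nothing = _ , refl , ℚ.≤-refl
  ... | just q  = _ , refl , ℚ.p⊓q≤p _ q
  minRatio-≤ (S′ ∷ Ss) (there S∈Ss) adm with minRatio-≤ Ss S∈Ss adm | admissible k G S′
  ... | q , eq , q≤r | false = q , eq , q≤r
  ... | q , eq , q≤r | true rewrite eq =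
    _ , refl , ℚ.≤-trans (ℚ.p⊓q≤q (ratio ∣ Λ k G S′ ∣ ∣ S′ ∣) q) q≤r

  β≤ratio : ∀ {S} → k ≤ n → k ≤ ∣ S ∣ → Λ k G S ≢ ⊤ → β k G ≤ℚ ratio ∣ Λ k G S ∣ ∣ S ∣
  β≤ratio {S} k≤n k≤∣S∣ Λ≢⊤
    with minRatio-≤ (allSubsets n) (∈-allSubsets S) (admissible⁺ k≤∣S∣ Λ≢⊤) | n <ᵇ k in n<ᵇk
  ... | _ , _  , _   | true  = contradiction (ℕ.<ᵇ⇒< n k (Equivalence.from Bool.T-≡ n<ᵇk)) (ℕ.≤⇒≯ k≤n)
  ... | _ , eq , q≤r | false rewrite eq = q≤r

  0<β⇒k≤n : 0ℚ < β k G → k ≤ n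
  0<β⇒k≤n 0<β with n <ᵇ k in n<ᵇk
  ... | true  = contradiction 0<β (ℚ.<-irrefl refl)
  ... | false = ℕ.≮⇒≥ (λ n<k → subst T n<ᵇk (ℕ.<⇒<ᵇ n<k))

  β≤ratio[∣Λ∣,k] : .{{_ : NonZero k}} → k ≤ n → ∀ {S} → ∣ S ∣ ≡ k → β k G ≤ℚ ratio ∣ Λ k G S ∣ k
  β≤ratio[∣Λ∣,k] k≤n {S} ∣S∣≡k = subst (λ s → β k G ≤ℚ ratio ∣ Λ k G S ∣ s) ∣S∣≡k
    (β≤ratio {S} k≤n (ℕ.≤-reflexive (≡.sym ∣S∣≡k)) (Λ≢⊤ G ∣S∣≡k))

  0<β⇒Nonempty-Λ : .{{_ : NonZero k}} → 0ℚ < β k G → ∀ {S} → ∣ S ∣ ≡ k → Nonempty (Λ k G S)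
  0<β⇒Nonempty-Λ 0<β ∣S∣≡k = ∣p∣>0⇒Nonempty
    (0<ratio[a,d]⇒0<a _ k (ℚ.<-≤-trans 0<β (β≤ratio[∣Λ∣,k] (0<β⇒k≤n 0<β) ∣S∣≡k)))

  0<β⇒common-neighbour : .{{_ : NonZero k}} → 0ℚ < β k G → ∀ {A} → ∣ A ∣ ≤ k → ∃ λ x → A ⊆ N G x
  0<β⇒common-neighbour 0<β {A} ∣A∣≤k with superset-of-size k A ∣A∣≤k (0<β⇒k≤n 0<β)
  ... | S , A⊆S , ∣S∣≡k with 0<β⇒Nonempty-Λ 0<β ∣S∣≡k
  ... | x , x∈Λ = x , ∈Λ⇒⊆N G ∣S∣≡k x∈Λ ∘ A⊆S

  0<β⇒triangle : 2 ≤ k → 0ℚ < β k G → Triangle G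
  0<β⇒triangle 2≤k 0<β = triangle
    where
    0<k : 0 ℕ.< k
    0<k = ℕ.<-≤-trans z<s 2≤k

    instance
      k≢0 : NonZero k
      k≢0 = ℕ.>-nonZero 0<k

    common-neighbour : ∀ {A} → ∣ A ∣ ≤ k → ∃ λ x → A ⊆ N G x
    common-neighbour = 0<β⇒common-neighbour 0<β

    ∣⊥∣≤k : ∣ ⊥ {n} ∣ ≤ k
    ∣⊥∣≤k = ℕ.≤-trans (ℕ.≤-reflexive (Subset.∣⊥∣≡0 n)) z≤n

    ∣⁅x⁆∣≤k : ∀ x → ∣ ⁅ x ⁆ ∣ ≤ k
    ∣⁅x⁆∣≤k x = ℕ.≤-trans (ℕ.≤-reflexive (Subset.∣⁅x⁆∣≡1 x)) 0<k

    triangle : Triangle G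
    triangle with common-neighbour {⊥} ∣⊥∣≤k
    ... | w , _ with common-neighbour {⁅ w ⁆} (∣⁅x⁆∣≤k w)
    ... | u , w∈Nu with common-neighbour {⁅ w ⁆ ∪ ⁅ u ⁆} (ℕ.≤-trans (∣⁅x⁆∪⁅y⁆∣≤2 w u) 2≤k)
    ... | x , w,u∈Nx = record
      { x = x ; y = u ; z = w
      ; xy = ∈N⇒adj G (w,u∈Nx (Subset.q⊆p∪q ⁅ w ⁆ ⁅ u ⁆ (Subset.x∈⁅x⁆ u)))
      ; yz = ∈N⇒adj G (w∈Nu (Subset.x∈⁅x⁆ w))
      ; xz = ∈N⇒adj G (w,u∈Nx (Subset.p⊆p∪q ⁅ u ⁆ (Subset.x∈⁅x⁆ w)))
      }

  k*β≤n-k : .{{_ : NonZero k}} → 0ℚ < β k G → (+ k / 1) *ℚ β k G ≤ℚ (+ n / 1) -ℚ (+ k / 1)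
  k*β≤n-k 0<β with subset-of-size k (0<β⇒k≤n 0<β)
  ... | S , ∣S∣≡k = begin
    (+ k / 1) *ℚ β k G     ≤⟨ [k]*-mono-≤ k (β≤ratio[∣Λ∣,k] k≤n ∣S∣≡k) ⟩
    (+ k / 1) *ℚ ratio a k ≡⟨ k*ratio[a,k]≡a a k ⟩
    + a / 1                ≤⟨ a≤b⇒[a]≤[b] (ℕ.m+n≤o⇒m≤o∸n a (∣Λ∣+k≤n G {S = S} ∣S∣≡k)) ⟩
    + (n ∸ k) / 1          ≡⟨ [n]-[k]≡[n∸k] k≤n ⟨
    (+ n / 1) -ℚ (+ k / 1) ∎
    where
    open ℚ.≤-Reasoning
    k≤n = 0<β⇒k≤n 0<β
    a = ∣ Λ k G S ∣

  1≤β⇒2k≤n : .{{_ : NonZero k}} → 1ℚ ≤ℚ β k G → 2 * k ≤ n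
  1≤β⇒2k≤n 1≤β =
    ℕ.≤-trans (ℕ.+-monoʳ-≤ k (ℕ.≤-reflexive (ℕ.+-identityʳ k))) (ℕ.m≤o∸n⇒m+n≤o k k≤n k≤n∸k)
    where
    0<β = ℚ.<-≤-trans (ℚ.positive⁻¹ 1ℚ) 1≤β
    k≤n = 0<β⇒k≤n 0<β

    k≤n∸k : k ≤ n ∸ k
    k≤n∸k = [a]≤[b]⇒a≤b (begin
      + k / 1                  ≡⟨ ℚ.*-identityʳ (+ k / 1) ⟨
      (+ k / 1) *ℚ 1ℚ          ≤⟨ [k]*-mono-≤ k 1≤β ⟩
      (+ k / 1) *ℚ β k G       ≤⟨ k*β≤n-k 0<β ⟩
      (+ n / 1) -ℚ (+ k / 1)   ≡⟨ [n]-[k]≡[n∸k] k≤n ⟩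
      + (n ∸ k) / 1            ∎)
      where open ℚ.≤-Reasoning

mainTheorem5 : (k : ℕ) → 2 ≤ k → (n : ℕ) → (G : Graph n) →
    (0ℚ < β k G →
      ¬ Bipartite G × (+ k / 1) *ℚ β k G ≤ℚ (+ n / 1) -ℚ (+ k / 1))
    × (1ℚ ≤ℚ β k G → 2 * k ≤ n)
mainTheorem5 k@(suc _) 2≤k n G =
  (λ 0<β → triangle⇒¬bipartite (0<β⇒triangle 2≤k 0<β) , k*β≤n-k {G = G} 0<β) , 1≤β⇒2k≤n {G = G}
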